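{- Let $u\le w$ in $\mathbb{P}^*$ under generalized factor order and $C: w=v_0\to\dots\to v_n=u$ a maximal chain of $[u,w]$ with chain id $l_1\cdots l_n$. Suppose $v_i$ is a descent. Then $\{v_i\}$ is a (length 1) minimally skipped interval of $C$ if and only if $v_i$ is strong, i.e. $v_{i-1}\ne v_{i+1}11$.
   Context: $\mathbb{P}=\{1,2,\dots\}$. Generalized factor order on $\mathbb{P}^*$: $u\le w$ iff for some $i\ge0$, $u(j)\le w(i+j)$ for $1\le j\le |u|$. Basic notions. - A word is flat if all its letters are $1$. - An embedding of $v$ into $w$ is $\eta\in0^*v0^*$ of length $|w|$ with $\eta(k)\le w(k)$. - In an embedding of $v$, a letter is reducible if it is $>1$, or it is a $1$ that is the first nonzero letter, or $v$ is not flat and it is a $1$ that is the last nonzero letter. Reducing subtracts $1$. Chain ids. The chain id is $l_1\cdots l_n$ with $\eta_{v_0}=w$ and $\eta_{v_k}$ obtained from $\eta_{v_{k-1}}$ by reducing the reducible letter at position $l_k$. Chains are ordered lexicographically by chain id. - $v_i$ is a descent if $l_i>l_{i+1}$. Skipped intervals. $C(v_i,v_j)=\{v_{i+1},\dots,v_{j-1}\}$. A nonempty $C(v_i,v_j)$ is skipped if $C\setminus C(v_i,v_j)\subseteq C'$ for some earlier maximal chain $C'$. It is minimally skipped if it properly contains no skipped interval. -}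

module Defs where

open import Data.Nat using (ℕ; zero; suc; _≤_; _<_; pred; _+_)
open import Data.Nat.Properties using ()
open import Data.Fin using (Fin; toℕ)
open import Data.List using (List; []; _∷_; _++_; length; take; drop; replicate; map; upTo; lookup)
open import Data.List.Relation.Unary.All using (All)
open import Data.List.Relation.Binary.Pointwise using (Pointwise)
open import Data.List.Relation.Binary.Lex.Strict using (Lex-<)
open import Data.Product using (Σ; ∃; ∃-syntax; ∃₂; _×_)
open import Data.Sum using (_⊎_)
open import Data.Empty using (⊥)
open import Relation.Nullary using (¬_)
open import Relation.Binary.PropositionalEquality using (_≡_; _≢_)

-- Words over ℕ; a word of ℙ* is a word all of whose letters are ≥ 1.
Word : Set
Word = List ℕ

Pos : Word → Set
Pos w = All (λ a → 1 ≤ a) w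

-- Generalized factor order: u ≤ w iff for some i ≥ 0, u(j) ≤ w(i+j) for 1 ≤ j ≤ |u|
-- (the factor of w of length |u| starting after position i exists and dominates u).
_≼_ : Word → Word → Set
u ≼ w = ∃[ i ] Pointwise _≤_ u (take (length u) (drop i w))

_≺_ : Word → Word → Set
u ≺ w = u ≼ w × u ≢ w

_⋖_ : Word → Word → Set
u ⋖ w = u ≺ w × (∀ x → Pos x → u ≺ x → x ≺ w → ⊥)

-- A maximal chain C : w = v₀ → v₁ → … → vₙ = u of the (finite) interval [u,w],
-- given by C k = v_k for 0 ≤ k ≤ n (values for k > n are irrelevant).
MaxChain : Word → Word → (n : ℕ) → (ℕ → Word) → Set
MaxChain u w n C =
  C 0 ≡ w × C n ≡ u × (∀ k → k ≤ n → Pos (C k)) × (∀ k → k < n → C (suc k) ⋖ C k)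

Flat : Word → Set
Flat v = All (λ a → a ≡ 1) v

Padded : Word → List ℕ → Set
Padded v η = ∃₂ λ a b → η ≡ replicate a 0 ++ v ++ replicate b 0

IsEmbedding : Word → Word → List ℕ → Set
IsEmbedding v w η = Padded v η × Pointwise _≤_ η w

ReducibleLetter : (v : Word) → Fin (length v) → Set
ReducibleLetter v j =
  (1 < lookup v j)
  ⊎ (lookup v j ≡ 1 × toℕ j ≡ 0)
  ⊎ (¬ Flat v × lookup v j ≡ 1 × suc (toℕ j) ≡ length v)

-- In the embedding η of v, the letter at (1-indexed) position p of η is reducible.
Reducible : Word → List ℕ → ℕ → Set
Reducible v η p =
  ∃₂ λ a b → η ≡ replicate a 0 ++ v ++ replicate b 0 ×
    Σ (Fin (length v)) λ j → p ≡ suc (a + toℕ j) × ReducibleLetter v j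

-- subtract 1 from the letter at (1-indexed) position p
decAt : ℕ → List ℕ → List ℕ
decAt zero xs = xs
decAt (suc p) [] = []
decAt (suc zero) (x ∷ xs) = pred x ∷ xs
decAt (suc (suc p)) (x ∷ xs) = x ∷ decAt (suc p) xs

-- l₁ ⋯ lₙ (given as l 1, …, l n) is the chain id of the chain C from w:
-- η_{v₀} = w, η_{v_k} is obtained from η_{v_{k-1}} by reducing the reducible
-- letter at position l_k, and η_{v_k} is an embedding of v_k into w.
HasChainId : Word → (n : ℕ) → (ℕ → Word) → (ℕ → ℕ) → Set
HasChainId w n C l =
  Σ (ℕ → List ℕ) λ η → η 0 ≡ w ×
    (∀ k → k < n →
       Reducible (C k) (η k) (l (suc k)) ×
       η (suc k) ≡ decAt (l (suc k)) (η k) ×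
       IsEmbedding (C (suc k)) w (η (suc k)))

idList : ℕ → (ℕ → ℕ) → List ℕ
idList n l = map l (map suc (upTo n))

_<lex_ : List ℕ → List ℕ → Set
_<lex_ = Lex-< _≡_ _<_

InChain : ℕ → (ℕ → Word) → Word → Set
InChain n C v = ∃[ m ] (m ≤ n × C m ≡ v)

-- C(v_i, v_j) = {v_{i+1},…,v_{j-1}} (nonempty, i.e. i+2 ≤ j ≤ n) is skipped in the
-- maximal chain C of [u,w] with chain id l: C ∖ C(v_i,v_j) ⊆ C' for some
-- earlier (lexicographically smaller chain id) maximal chain C' of [u,w].
Skipped : Word → Word → (n : ℕ) → (ℕ → Word) → (ℕ → ℕ) → ℕ → ℕ → Set
Skipped u w n C l i j =
  suc i < j × j ≤ n ×
  ∃[ n' ] Σ (ℕ → Word) λ C' → Σ (ℕ → ℕ) λ l' →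
    MaxChain u w n' C' × HasChainId w n' C' l' × (idList n' l' <lex idList n l) ×
    (∀ k → k ≤ n → (k ≤ i ⊎ j ≤ k) → InChain n' C' (C k))

-- minimally skipped: skipped and properly contains no skipped interval
-- (for nonempty index ranges, C(v_i',v_j') ⊊ C(v_i,v_j) iff i ≤ i', j' ≤ j, (i',j') ≠ (i,j))
MinSkipped : Word → Word → (n : ℕ) → (ℕ → Word) → (ℕ → ℕ) → ℕ → ℕ → Set
MinSkipped u w n C l i j =
  Skipped u w n C l i j ×
  (∀ i' j' → Skipped u w n C l i' j' → i ≤ i' → j' ≤ j → (i' ≢ i ⊎ j' ≢ j) → ⊥)

-- Every covering step of ℙ* lowers the letter sum by exactly one, so all maximal chains of [u,w] have
-- the same length, each vertex sits at the index fixed by its letter sum, and the position reduced in a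
-- step is determined by the two words and the embedding. Hence an earlier chain containing every vertex
-- of C except v_i coincides with C elsewhere, and its chain id first falls below l_i at step i: from the
-- embedding of v_{i-1} it reduces at a lower position and reaches v_{i+1} through another word. For
-- v_{i-1} = v_{i+1}11 a case analysis shows there is no such route. Conversely, when v_{i-1} is strong,
-- the descent l_{i+1} < l_i lets the two reductions be performed in the opposite order; if this leaves a
-- flat word whose last 1 is no longer reducible, its first 1 is deleted instead and all later embeddings
-- move one place to the right. This gives the earlier chain, and a one-element interval is minimal.
module Submission where

open import Defs
open import Data.Nat
open import Data.Nat.Properties
open import Data.Nat.ListAction using (sum)
open import Data.Nat.ListAction.Properties using (sum-++)
open import Data.Fin using (Fin; toℕ; fromℕ<)
open import Data.Fin.Properties using (toℕ-fromℕ<; toℕ<n)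
open import Data.List using (List; []; _∷_; _++_; length; take; drop; replicate; map; lookup; applyUpTo)
open import Data.List.Properties
  using (take-all; ++-assoc; length-++; length-replicate; ++-identityʳ; ++-cancelˡ; ∷-injective; ∷-injectiveˡ; ∷-injectiveʳ; map-applyUpTo)
open import Data.List.Relation.Unary.All using (All; []; _∷_; all?)
import Data.List.Relation.Unary.All.Properties as All
open import Data.List.Relation.Binary.Pointwise using (Pointwise; []; _∷_)
import Data.List.Relation.Binary.Pointwise as Pointwise
open import Data.List.Relation.Binary.Lex.Strict using (Lex-<)
open import Data.List.Relation.Binary.Lex using (base; this; next)
open import Data.Product using (Σ; _×_; _,_; proj₁; proj₂)
open import Data.Sum using (_⊎_; inj₁; inj₂)
open import Data.Empty using (⊥; ⊥-elim)
open import Function.Base using (_∘_)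
open import Function.Bundles using (_⇔_; mk⇔)
open import Relation.Nullary using (¬_; Dec; yes; no)
open import Relation.Binary.PropositionalEquality
open import Relation.Binary.Definitions using (tri<; tri≈; tri>)

-- Padded words

positive≢0 : ∀ {x} → 1 ≤ x → x ≢ 0
positive≢0 () refl

zeros : ℕ → List ℕ
zeros a = replicate a 0

zeros-++ : ∀ a b → zeros a ++ zeros b ≡ zeros (a + b)
zeros-++ zero b = refl
zeros-++ (suc a) b = cong (0 ∷_) (zeros-++ a b)

All-zeros : ∀ a → All (_≡ 0) (zeros a)
All-zeros zero = []
All-zeros (suc a) = refl ∷ All-zeros a

Pos∧zeros⇒[] : ∀ {y} → Pos y → All (_≡ 0) y → y ≡ []
Pos∧zeros⇒[] [] [] = refl
Pos∧zeros⇒[] (() ∷ _) (refl ∷ _)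

Pos-inside-zeros⇒[] : ∀ {y} b c d → Pos y → zeros b ≡ zeros c ++ y ++ zeros d → y ≡ []
Pos-inside-zeros⇒[] {y} b c d py e =
  Pos∧zeros⇒[] py (All.++⁻ˡ y (All.++⁻ʳ (zeros c) (subst (All (_≡ 0)) e (All-zeros b))))

++zeros-injective : ∀ {x y} b d → Pos x → Pos y → x ++ zeros b ≡ y ++ zeros d → x ≡ y
++zeros-injective {[]} {y} b d _ py e = sym (Pos-inside-zeros⇒[] b 0 d py e)
++zeros-injective {x ∷ xs} {[]} b d px _ e = Pos-inside-zeros⇒[] d 0 b px (sym e)
++zeros-injective {x ∷ xs} {y ∷ ys} b d (_ ∷ px) (_ ∷ py) e with ∷-injective e
... | refl , e′ = cong (x ∷_) (++zeros-injective b d px py e′)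

padded-injective : ∀ a b c d {x y} → Pos x → Pos y →
  zeros a ++ x ++ zeros b ≡ zeros c ++ y ++ zeros d → x ≡ y
padded-injective zero b zero d px py e = ++zeros-injective b d px py e
padded-injective (suc a) b (suc c) d px py e = padded-injective a b c d px py (∷-injectiveʳ e)
padded-injective zero b (suc c) d {[]} {y} px py e = sym (Pos-inside-zeros⇒[] b (suc c) d py e)
padded-injective zero b (suc c) d {x ∷ _} (p ∷ _) py e = ⊥-elim (positive≢0 p (∷-injectiveˡ e))
padded-injective (suc a) b zero d {x} {[]} px py e = Pos-inside-zeros⇒[] d (suc a) b px (sym e)
padded-injective (suc a) b zero d {y = y ∷ _} px (p ∷ _) e = ⊥-elim (positive≢0 p (sym (∷-injectiveˡ e)))

zeros-injective : ∀ {a b} → zeros a ≡ zeros b → a ≡ b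
zeros-injective {a} {b} e = trans (sym (length-replicate a)) (trans (cong length e) (length-replicate b))

padding-injective : ∀ a b c d {x} → Pos x → 0 < length x →
  zeros a ++ x ++ zeros b ≡ zeros c ++ x ++ zeros d → a ≡ c × b ≡ d
padding-injective zero b zero d {x} _ _ e = refl , zeros-injective (++-cancelˡ x _ _ e)
padding-injective (suc a) b (suc c) d px lt e with padding-injective a b c d px lt (∷-injectiveʳ e)
... | refl , refl = refl , refl
padding-injective zero b (suc c) d {x ∷ _} (p ∷ _) _ e = ⊥-elim (positive≢0 p (∷-injectiveˡ e))
padding-injective (suc a) b zero d {x ∷ _} (p ∷ _) _ e = ⊥-elim (positive≢0 p (sym (∷-injectiveˡ e)))

nth : List ℕ → ℕ → ℕ
nth [] _ = 0
nth (x ∷ xs) zero = x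
nth (x ∷ xs) (suc j) = nth xs j

nth-++ˡ : ∀ j (xs ys : List ℕ) → j < length xs → nth (xs ++ ys) j ≡ nth xs j
nth-++ˡ zero (x ∷ xs) ys _ = refl
nth-++ˡ (suc j) (x ∷ xs) ys (s≤s lt) = nth-++ˡ j xs ys lt

nth-last : ∀ (t : List ℕ) x → nth (t ++ x ∷ []) (length t) ≡ x
nth-last [] x = refl
nth-last (y ∷ t) x = nth-last t x

lookup≡nth : ∀ v (j : Fin (length v)) → lookup v j ≡ nth v (toℕ j)
lookup≡nth (x ∷ v) Fin.zero = refl
lookup≡nth (x ∷ v) (Fin.suc j) = lookup≡nth v j

length-snoc : ∀ (t : List ℕ) x → length (t ++ x ∷ []) ≡ suc (length t)
length-snoc [] x = refl
length-snoc (y ∷ t) x = cong suc (length-snoc t x)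

length<length-snoc : ∀ (X : List ℕ) → length X < length (X ++ 1 ∷ [])
length<length-snoc X = ≤-reflexive (sym (length-snoc X 1))

length-padded : ∀ a v b → length (zeros a ++ v ++ zeros b) ≡ a + (length v + b)
length-padded a v b rewrite length-++ (zeros a) {v ++ zeros b} | length-++ v {zeros b}
  | length-replicate a {0} | length-replicate b {0} = refl

length-decAt : ∀ p xs → length (decAt p xs) ≡ length xs
length-decAt zero xs = refl
length-decAt (suc p) [] = refl
length-decAt (suc zero) (x ∷ xs) = refl
length-decAt (suc (suc p)) (x ∷ xs) = cong suc (length-decAt (suc p) xs)

decAt-≤ : ∀ p xs → Pointwise _≤_ (decAt p xs) xs
decAt-≤ zero xs = Pointwise.refl ≤-refl
decAt-≤ (suc p) [] = []
decAt-≤ (suc zero) (x ∷ xs) = pred[n]≤n ∷ Pointwise.refl ≤-refl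
decAt-≤ (suc (suc p)) (x ∷ xs) = ≤-refl ∷ decAt-≤ (suc p) xs

decAt-comm : ∀ p q xs → decAt p (decAt q xs) ≡ decAt q (decAt p xs)
decAt-comm zero q xs = refl
decAt-comm (suc p) zero xs = refl
decAt-comm (suc p) (suc q) [] = refl
decAt-comm (suc zero) (suc zero) (x ∷ xs) = refl
decAt-comm (suc zero) (suc (suc q)) (x ∷ xs) = refl
decAt-comm (suc (suc p)) (suc zero) (x ∷ xs) = refl
decAt-comm (suc (suc p)) (suc (suc q)) (x ∷ xs) = cong (x ∷_) (decAt-comm (suc p) (suc q) xs)

nth-decAt-≢ : ∀ j k v → j ≢ k → nth (decAt (suc j) v) k ≡ nth v k
nth-decAt-≢ j k [] ne = refl
nth-decAt-≢ zero zero (x ∷ v) ne = ⊥-elim (ne refl)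
nth-decAt-≢ zero (suc k) (x ∷ v) ne = refl
nth-decAt-≢ (suc j) zero (x ∷ v) ne = refl
nth-decAt-≢ (suc j) (suc k) (x ∷ v) ne = nth-decAt-≢ j k v (ne ∘ cong suc)

nth-decAt-≡ : ∀ j v → nth (decAt (suc j) v) j ≡ pred (nth v j)
nth-decAt-≡ j [] = refl
nth-decAt-≡ zero (x ∷ v) = refl
nth-decAt-≡ (suc j) (x ∷ v) = nth-decAt-≡ j v

decAt-injective : ∀ j j' v → 1 ≤ nth v j → decAt (suc j) v ≡ decAt (suc j') v → j ≡ j'
decAt-injective j j' v le e with j ≟ j'
... | yes j≡j' = j≡j'
... | no j≢j' = ⊥-elim (pred≢ le (begin
  pred (nth v j)            ≡⟨ nth-decAt-≡ j v ⟨
  nth (decAt (suc j) v) j   ≡⟨ cong (λ z → nth z j) e ⟩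
  nth (decAt (suc j') v) j  ≡⟨ nth-decAt-≢ j' j v (j≢j' ∘ sym) ⟩
  nth v j                   ∎))
  where
  open ≡-Reasoning
  pred≢ : ∀ {x} → 1 ≤ x → pred x ≢ x
  pred≢ {suc y} _ = <⇒≢ (n<1+n y)

decAt-0∷ : ∀ p xs → decAt (suc p) (0 ∷ xs) ≡ 0 ∷ decAt p xs
decAt-0∷ zero xs = refl
decAt-0∷ (suc p) xs = refl

decAt-zeros : ∀ a p ys → decAt (a + p) (zeros a ++ ys) ≡ zeros a ++ decAt p ys
decAt-zeros zero p ys = refl
decAt-zeros (suc a) p ys = trans (decAt-0∷ (a + p) _) (cong (0 ∷_) (decAt-zeros a p ys))

decAt-++ˡ : ∀ j xs ys → j < length xs → decAt (suc j) (xs ++ ys) ≡ decAt (suc j) xs ++ ys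
decAt-++ˡ zero (x ∷ xs) ys _ = refl
decAt-++ˡ (suc j) (x ∷ xs) ys (s≤s lt) = cong (x ∷_) (decAt-++ˡ j xs ys lt)

decAt-snoc : ∀ t x → decAt (suc (length t)) (t ++ x ∷ []) ≡ t ++ pred x ∷ []
decAt-snoc [] x = refl
decAt-snoc (y ∷ t) x = cong (y ∷_) (decAt-snoc t x)

decAt-padded : ∀ a b j v → j < length v →
  decAt (suc (a + j)) (zeros a ++ v ++ zeros b) ≡ zeros a ++ decAt (suc j) v ++ zeros b
decAt-padded a b j v lt rewrite sym (+-suc a j) =
  trans (decAt-zeros a (suc j) (v ++ zeros b)) (cong (zeros a ++_) (decAt-++ˡ j v (zeros b) lt))

decAt-padded-head : ∀ a b v → decAt (suc (a + 0)) (zeros a ++ (1 ∷ v) ++ zeros b) ≡ zeros (suc a) ++ v ++ zeros b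
decAt-padded-head a b v = trans (decAt-padded a b 0 (1 ∷ v) (s≤s z≤n)) (zeros-++-0∷ a _)
  where
  zeros-++-0∷ : ∀ a xs → zeros a ++ 0 ∷ xs ≡ 0 ∷ zeros a ++ xs
  zeros-++-0∷ zero xs = refl
  zeros-++-0∷ (suc a) xs = cong (0 ∷_) (zeros-++-0∷ a xs)

decAt-padded-last : ∀ a b v →
  decAt (suc (a + length v)) (zeros a ++ (v ++ 1 ∷ []) ++ zeros b) ≡ zeros a ++ v ++ zeros (suc b)
decAt-padded-last a b v = begin
  decAt (suc (a + length v)) (zeros a ++ (v ++ 1 ∷ []) ++ zeros b)
    ≡⟨ decAt-padded a b (length v) (v ++ 1 ∷ []) (length<length-snoc v) ⟩
  zeros a ++ decAt (suc (length v)) (v ++ 1 ∷ []) ++ zeros b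
    ≡⟨ cong (λ z → zeros a ++ z ++ zeros b) (decAt-snoc v 1) ⟩
  zeros a ++ (v ++ 0 ∷ []) ++ zeros b
    ≡⟨ cong (zeros a ++_) (++-assoc v (0 ∷ []) (zeros b)) ⟩
  zeros a ++ v ++ zeros (suc b) ∎
  where open ≡-Reasoning

-- Reductions and covering relations

ReducibleAt : Word → ℕ → Set
ReducibleAt v j = 2 ≤ nth v j ⊎ (nth v j ≡ 1 × j ≡ 0) ⊎ (¬ Flat v × nth v j ≡ 1 × suc j ≡ length v)

reducibleLetter⇒reducibleAt : ∀ v (j : Fin (length v)) → ReducibleLetter v j → ReducibleAt v (toℕ j)
reducibleLetter⇒reducibleAt v j r rewrite lookup≡nth v j = r

reducibleAt⇒reducibleLetter : ∀ v j (lt : j < length v) → ReducibleAt v j → ReducibleLetter v (fromℕ< lt)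
reducibleAt⇒reducibleLetter v j lt r rewrite lookup≡nth v (fromℕ< lt) | toℕ-fromℕ< lt = r

-- Reducing a first or last letter 1 turns it into a 0 of the embedding, so it leaves the word.
data Reduction (v : Word) (j : ℕ) (v' : Word) : Set where
  decrement : 2 ≤ nth v j → v' ≡ decAt (suc j) v → Reduction v j v'
  drop-first : j ≡ 0 → v ≡ 1 ∷ v' → Reduction v j v'
  drop-last : suc j ≡ length v → ¬ Flat v → v ≡ v' ++ 1 ∷ [] → Reduction v j v'

Pos-decAt : ∀ j v → Pos v → 2 ≤ nth v j → Pos (decAt (suc j) v)
Pos-decAt j [] p le = []
Pos-decAt zero (suc (suc x) ∷ v) (_ ∷ p) le = s≤s z≤n ∷ p
Pos-decAt zero (suc zero ∷ v) _ (s≤s ())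
Pos-decAt (suc j) (x ∷ v) (q ∷ p) le = q ∷ Pos-decAt j v p le

split-last : ∀ j v → suc j ≡ length v → Σ Word λ t → v ≡ t ++ nth v j ∷ []
split-last zero (x ∷ []) e = [] , refl
split-last (suc j) (x ∷ v) e with split-last j v (suc-injective e)
... | t , v≡t∷ʳ = x ∷ t , cong (x ∷_) v≡t∷ʳ

reduce : ∀ v j → Pos v → ReducibleAt v j → Σ Word λ v' → Pos v' × Reduction v j v'
reduce v j pv (inj₁ le) = decAt (suc j) v , Pos-decAt j v pv le , decrement le refl
reduce (x ∷ v) .zero (_ ∷ pv) (inj₂ (inj₁ (e , refl))) = v , pv , drop-first refl (cong (_∷ v) e)
reduce v j pv (inj₂ (inj₂ (nf , e , l))) with split-last j v l
... | t , v≡t∷ʳ = t , All.++⁻ˡ t (subst Pos v≡t∷ʳ pv) , drop-last l nf (trans v≡t∷ʳ (cong (λ z → t ++ z ∷ []) e))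

sum-decAt : ∀ j v → 1 ≤ nth v j → suc (sum (decAt (suc j) v)) ≡ sum v
sum-decAt zero (suc x ∷ v) le = refl
sum-decAt (suc j) (x ∷ v) le = trans (sym (+-suc x _)) (cong (x +_) (sum-decAt j v le))

sum-reduction : ∀ {v j v'} → Reduction v j v' → suc (sum v') ≡ sum v
sum-reduction {v} {j} (decrement le refl) = sum-decAt j v (≤-trans (s≤s z≤n) le)
sum-reduction (drop-first _ refl) = refl
sum-reduction {v' = v'} (drop-last _ _ refl) rewrite sum-++ v' (1 ∷ []) = sym (+-comm (sum v') 1)

Pointwise-≤⇒sum≤ : ∀ {xs ys} → Pointwise _≤_ xs ys → sum xs ≤ sum ys
Pointwise-≤⇒sum≤ [] = z≤n
Pointwise-≤⇒sum≤ (p ∷ ps) = +-mono-≤ p (Pointwise-≤⇒sum≤ ps)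

Pointwise-≤∧sum≡⇒≡ : ∀ {xs ys} → Pointwise _≤_ xs ys → sum xs ≡ sum ys → xs ≡ ys
Pointwise-≤∧sum≡⇒≡ [] e = refl
Pointwise-≤∧sum≡⇒≡ {x ∷ _} {y ∷ _} (p ∷ ps) e with m≤n⇒m<n∨m≡n p
... | inj₁ x<y = ⊥-elim (<-irrefl e (+-mono-<-≤ x<y (Pointwise-≤⇒sum≤ ps)))
... | inj₂ refl = cong (x ∷_) (Pointwise-≤∧sum≡⇒≡ ps (+-cancelˡ-≡ x _ _ e))

sum-take≤ : ∀ m (ys : List ℕ) → sum (take m ys) ≤ sum ys
sum-take≤ zero ys = z≤n
sum-take≤ (suc m) [] = z≤n
sum-take≤ (suc m) (y ∷ ys) = +-monoʳ-≤ y (sum-take≤ m ys)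

sum-drop≤ : ∀ m (ys : List ℕ) → sum (drop m ys) ≤ sum ys
sum-drop≤ zero ys = ≤-refl
sum-drop≤ (suc m) [] = z≤n
sum-drop≤ (suc m) (y ∷ ys) = ≤-trans (sum-drop≤ m ys) (m≤n+m _ y)

Pos∧sum-take≡⇒take≡ : ∀ m ys → Pos ys → sum (take m ys) ≡ sum ys → take m ys ≡ ys
Pos∧sum-take≡⇒take≡ zero [] p e = refl
Pos∧sum-take≡⇒take≡ zero (y ∷ ys) (q ∷ p) e = ⊥-elim (<-irrefl e (≤-trans q (m≤m+n y _)))
Pos∧sum-take≡⇒take≡ (suc m) [] p e = refl
Pos∧sum-take≡⇒take≡ (suc m) (y ∷ ys) (q ∷ p) e = cong (y ∷_) (Pos∧sum-take≡⇒take≡ m ys p (+-cancelˡ-≡ y _ _ e))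

Pos∧sum-drop≡⇒drop≡ : ∀ m ys → Pos ys → sum (drop m ys) ≡ sum ys → drop m ys ≡ ys
Pos∧sum-drop≡⇒drop≡ zero ys p e = refl
Pos∧sum-drop≡⇒drop≡ (suc m) [] p e = refl
Pos∧sum-drop≡⇒drop≡ (suc m) (y ∷ ys) (q ∷ p) e =
  ⊥-elim (<-irrefl e (≤-trans (s≤s (sum-drop≤ m ys)) (+-monoˡ-≤ (sum ys) q)))

≤-squeeze : ∀ {a b c} → a ≤ b → b ≤ c → a ≡ c → a ≡ b × b ≡ c
≤-squeeze {a} a≤b b≤c refl = ≤-antisym a≤b b≤c , ≤-antisym b≤c a≤b

≼⇒sum≤ : ∀ {x y} → x ≼ y → sum x ≤ sum y
≼⇒sum≤ {x} {y} (i , pw) =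
  ≤-trans (Pointwise-≤⇒sum≤ pw) (≤-trans (sum-take≤ (length x) (drop i y)) (sum-drop≤ i y))

≼∧sum≡⇒≡ : ∀ {x y} → Pos y → x ≼ y → sum x ≡ sum y → x ≡ y
≼∧sum≡⇒≡ {x} {y} py (i , pw) e
  with ≤-squeeze (Pointwise-≤⇒sum≤ pw) (≤-trans (sum-take≤ (length x) (drop i y)) (sum-drop≤ i y)) e
... | e₁ , e₂ with ≤-squeeze (sum-take≤ (length x) (drop i y)) (sum-drop≤ i y) e₂
... | e₃ , e₄ = begin
  x                             ≡⟨ Pointwise-≤∧sum≡⇒≡ pw e₁ ⟩
  take (length x) (drop i y)    ≡⟨ Pos∧sum-take≡⇒take≡ (length x) (drop i y) (All.drop⁺ i py) e₃ ⟩
  drop i y                      ≡⟨ Pos∧sum-drop≡⇒drop≡ i y py e₄ ⟩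
  y                             ∎
  where open ≡-Reasoning

≺⇒sum< : ∀ {x y} → Pos y → x ≺ y → sum x < sum y
≺⇒sum< py (x≼y , x≢y) = ≤∧≢⇒< (≼⇒sum≤ x≼y) (x≢y ∘ ≼∧sum≡⇒≡ py x≼y)

sum<⇒≢ : ∀ {x y} → sum x < sum y → x ≢ y
sum<⇒≢ lt refl = <-irrefl refl lt

reduction-≼ : ∀ {v j v'} → Reduction v j v' → v' ≼ v
reduction-≼ {v} {j} (decrement _ refl) =
  0 , subst (Pointwise _≤_ (decAt (suc j) v)) (sym (take-all _ v (≤-reflexive (sym (length-decAt (suc j) v))))) (decAt-≤ (suc j) v)
reduction-≼ {v' = v'} (drop-first _ refl) = 1 , subst (Pointwise _≤_ v') (sym (take-all _ v' ≤-refl)) (Pointwise.refl ≤-refl)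
reduction-≼ {v' = v'} (drop-last _ _ refl) = 0 , subst (Pointwise _≤_ v') (sym (take-length-++ v')) (Pointwise.refl ≤-refl)
  where
  take-length-++ : ∀ (xs : List ℕ) {ys} → take (length xs) (xs ++ ys) ≡ xs
  take-length-++ [] = refl
  take-length-++ (x ∷ xs) = cong (x ∷_) (take-length-++ xs)

-- Nothing lies strictly between: ≺ strictly lowers the letter sum, which the reduction lowers by one.
reduction-⋖ : ∀ {v j v'} → Reduction v j v' → Pos v → Pos v' → v' ⋖ v
reduction-⋖ {v} {j} {v'} r pv pv' = (reduction-≼ r , sum<⇒≢ sum[v']<sum[v]) , no-between
  where
  sum[v']<sum[v] : sum v' < sum v
  sum[v']<sum[v] = ≤-reflexive (sum-reduction r)
  no-between : ∀ x → Pos x → v' ≺ x → x ≺ v → ⊥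
  no-between x px v'≺x x≺v = <⇒≱ (≺⇒sum< pv x≺v) (subst (_≤ sum x) (sum-reduction r) (≺⇒sum< px v'≺x))

++[x]≡x∷⇒All≡ : ∀ {x : ℕ} r → r ++ x ∷ [] ≡ x ∷ r → All (_≡ x) r
++[x]≡x∷⇒All≡ [] e = []
++[x]≡x∷⇒All≡ (z ∷ r) e with ∷-injective e
... | refl , e′ = refl ∷ ++[x]≡x∷⇒All≡ r e′

++[x,x]≡x∷x∷⇒All≡ : ∀ {x : ℕ} r → r ++ x ∷ x ∷ [] ≡ x ∷ x ∷ r → All (_≡ x) r
++[x,x]≡x∷x∷⇒All≡ [] e = []
++[x,x]≡x∷x∷⇒All≡ (z ∷ r) e with ∷-injective e
... | refl , e′ = refl ∷ ++[x,x]≡x∷x∷⇒All≡ r e′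

Flat⇒++[1]≡1∷ : ∀ t → Flat t → t ++ 1 ∷ [] ≡ 1 ∷ t
Flat⇒++[1]≡1∷ [] f = refl
Flat⇒++[1]≡1∷ (x ∷ t) (refl ∷ f) = cong (1 ∷_) (Flat⇒++[1]≡1∷ t f)

drop-first≢drop-last : ∀ {v v'} → ¬ Flat v → v ≡ 1 ∷ v' → v ≡ v' ++ 1 ∷ [] → ⊥
drop-first≢drop-last {v' = v'} nf refl e = nf (refl ∷ ++[x]≡x∷⇒All≡ v' (sym e))

length-reduction : ∀ {v j v'} → Reduction v j v' → length v' ≡ length v ⊎ suc (length v') ≡ length v
length-reduction {v} {j} (decrement _ refl) = inj₁ (length-decAt (suc j) v)
length-reduction (drop-first _ refl) = inj₂ refl
length-reduction {v' = v'} (drop-last _ _ refl) = inj₂ (sym (length-snoc v' 1))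

decAt≢tail : ∀ k v {x} → v ≢ x ∷ decAt (suc k) v
decAt≢tail k v e = 1+n≢n (sym (trans (cong length e) (cong suc (length-decAt (suc k) v))))

decAt≢init : ∀ k v {x} → v ≢ decAt (suc k) v ++ x ∷ []
decAt≢init k v {x} e = 1+n≢n (sym (trans (cong length e) (trans (length-snoc (decAt (suc k) v) x) (cong suc (length-decAt (suc k) v)))))

reduction-position-unique : ∀ {v j j' v'} → Reduction v j v' → Reduction v j' v' → j ≡ j'
reduction-position-unique {v} {j} {j'} (decrement le refl) (decrement _ e) = decAt-injective j j' v (≤-trans (s≤s z≤n) le) e
reduction-position-unique (drop-first refl _) (drop-first refl _) = refl
reduction-position-unique (drop-last l _ _) (drop-last l' _ _) = suc-injective (trans l (sym l'))
reduction-position-unique (drop-first _ e) (drop-last _ nf e') = ⊥-elim (drop-first≢drop-last nf e e')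
reduction-position-unique (drop-last _ nf e') (drop-first _ e) = ⊥-elim (drop-first≢drop-last nf e e')
reduction-position-unique {v} {j} (decrement _ refl) (drop-first _ e) = ⊥-elim (decAt≢tail j v e)
reduction-position-unique {v} {j} (decrement _ refl) (drop-last _ _ e) = ⊥-elim (decAt≢init j v e)
reduction-position-unique {v} {j' = j'} (drop-first _ e) (decrement _ refl) = ⊥-elim (decAt≢tail j' v e)
reduction-position-unique {v} {j' = j'} (drop-last _ _ e) (decrement _ refl) = ⊥-elim (decAt≢init j' v e)

decAt-padded-reduction : ∀ {v j v'} → Reduction v j v' → j < length v → ∀ a b →
  Σ ℕ λ a' → Σ ℕ λ b' → decAt (suc (a + j)) (zeros a ++ v ++ zeros b) ≡ zeros a' ++ v' ++ zeros b' × b ≤ b'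
decAt-padded-reduction {v} {j} (decrement _ refl) lt a b = a , b , decAt-padded a b j v lt , ≤-refl
decAt-padded-reduction (drop-first refl refl) lt a b = suc a , b , decAt-padded-head a b _ , ≤-refl
decAt-padded-reduction {v' = v'} (drop-last l _ refl) lt a b rewrite length-snoc v' 1 | suc-injective l =
  a , suc b , decAt-padded-last a b v' , n≤1+n b

record EmbeddedReduction (v η : List ℕ) (p : ℕ) (v' : Word) : Set where
  field
    before after letter : ℕ
    η≡padded : η ≡ zeros before ++ v ++ zeros after
    p≡position : p ≡ suc (before + letter)
    letter<length : letter < length v
    reducible : ReducibleAt v letter
    reduction : Reduction v letter v'

open EmbeddedReduction

embeddedReduction : ∀ {v η p v'} → Pos v → Reducible v η p → Pos v' → Padded v' (decAt p η) →
  EmbeddedReduction v η p v'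
embeddedReduction {v} {η} {p} {v'} pv (a , b , η≡ , j , p≡ , rj) pv' (c , d , decAt≡)
  with reduce v (toℕ j) pv (reducibleLetter⇒reducibleAt v j rj)
... | v″ , pv″ , r with decAt-padded-reduction r (toℕ<n j) a b
... | a' , b' , decAt≡′ , _ = record
  { before = a ; after = b ; letter = toℕ j ; η≡padded = η≡ ; p≡position = p≡ ; letter<length = toℕ<n j
  ; reducible = reducibleLetter⇒reducibleAt v j rj ; reduction = subst (Reduction v (toℕ j)) v″≡v' r }
  where
  v″≡v' : v″ ≡ v'
  v″≡v' = padded-injective a' b' c d pv″ pv' (trans (sym decAt≡′) (trans (cong₂ decAt (sym p≡) (sym η≡)) decAt≡))

reducible-padded : ∀ {v j} a b → j < length v → ReducibleAt v j → Reducible v (zeros a ++ v ++ zeros b) (suc (a + j))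
reducible-padded {v} {j} a b lt r =
  a , b , refl , fromℕ< lt , cong (λ z → suc (a + z)) (sym (toℕ-fromℕ< lt)) , reducibleAt⇒reducibleLetter v j lt r

embeddedReduction-position-unique : ∀ {v η p q v'} → Pos v → EmbeddedReduction v η p v' → EmbeddedReduction v η q v' → p ≡ q
embeddedReduction-position-unique pv R R′ with padding-injective (before R) (after R) (before R′) (after R′) pv
  (≤-trans (s≤s z≤n) (letter<length R)) (trans (sym (η≡padded R)) (η≡padded R′))
... | a≡a′ , _ = trans (p≡position R) (trans (cong₂ (λ x y → suc (x + y)) a≡a′ (reduction-position-unique (reduction R) (reduction R′))) (sym (p≡position R′)))

-- Maximal chains with chain ids

module Chain (w : Word) (n : ℕ) (C : ℕ → Word) (l : ℕ → ℕ)
  (C₀≡w : C 0 ≡ w) (posC : ∀ k → k ≤ n → Pos (C k)) (hasId : HasChainId w n C l) where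

  η : ℕ → List ℕ
  η = proj₁ hasId

  η₀≡w : η 0 ≡ w
  η₀≡w = proj₁ (proj₂ hasId)

  η-step : ∀ k → k < n → η (suc k) ≡ decAt (l (suc k)) (η k)
  η-step k lt = proj₁ (proj₂ (proj₂ (proj₂ hasId) k lt))

  padded : ∀ k → k ≤ n → Padded (C k) (η k)
  padded zero _ = 0 , 0 , trans η₀≡w (trans (sym C₀≡w) (sym (++-identityʳ (C 0))))
  padded (suc k) lt = proj₁ (proj₂ (proj₂ (proj₂ (proj₂ hasId) k lt)))

  η≤w : ∀ k → k ≤ n → Pointwise _≤_ (η k) w
  η≤w zero _ = subst (λ z → Pointwise _≤_ z w) (sym η₀≡w) (Pointwise.refl ≤-refl)
  η≤w (suc k) lt = proj₂ (proj₂ (proj₂ (proj₂ (proj₂ hasId) k lt)))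

  step : ∀ k → k < n → EmbeddedReduction (C k) (η k) (l (suc k)) (C (suc k))
  step k lt = embeddedReduction (posC k (<⇒≤ lt)) (proj₁ (proj₂ (proj₂ hasId) k lt)) (posC (suc k) lt)
    (subst (Padded (C (suc k))) (η-step k lt) (padded (suc k) lt))

  sum+index : ∀ k → k ≤ n → sum (C k) + k ≡ sum w
  sum+index zero _ = trans (+-identityʳ _) (cong sum C₀≡w)
  sum+index (suc k) lt = trans (+-suc _ k) (trans (cong (_+ k) (sum-reduction (reduction (step k lt)))) (sum+index k (<⇒≤ lt)))

  covers : ∀ k → k < n → C (suc k) ⋖ C k
  covers k lt = reduction-⋖ (reduction (step k lt)) (posC k (<⇒≤ lt)) (posC (suc k) lt)

  η-antitone : ∀ m k → m ≤ k → k ≤ n → Pointwise _≤_ (η k) (η m)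
  η-antitone m zero z≤n _ = Pointwise.refl ≤-refl
  η-antitone m (suc k) m≤1+k 1+k≤n with m≤n⇒m<n∨m≡n m≤1+k
  ... | inj₂ refl = Pointwise.refl ≤-refl
  ... | inj₁ m<1+k = Pointwise.transitive ≤-trans
    (subst (λ z → Pointwise _≤_ z (η k)) (sym (η-step k 1+k≤n)) (decAt-≤ _ _)) (η-antitone m k (s≤s⁻¹ m<1+k) (<⇒≤ 1+k≤n))

  trailing-zeros-step : ∀ k → k < n → ∀ {a b} → η k ≡ zeros a ++ C k ++ zeros b →
    Σ ℕ λ a′ → Σ ℕ λ b′ → η (suc k) ≡ zeros a′ ++ C (suc k) ++ zeros b′ × b ≤ b′
  trailing-zeros-step k k<n {a} {b} e =
    let R = step k k<n
        (_ , after≡b) = padding-injective (before R) (after R) a b (posC k (<⇒≤ k<n))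
                          (≤-trans (s≤s z≤n) (letter<length R)) (trans (sym (η≡padded R)) e)
        (a′ , b′ , e′ , after≤b′) = decAt-padded-reduction (reduction R) (letter<length R) (before R) (after R)
    in a′ , b′ , trans (η-step k k<n) (trans (cong₂ decAt (p≡position R) (η≡padded R)) e′) , subst (_≤ b′) after≡b after≤b′

  trailing-zeros-grow : ∀ m k → m ≤ k → k ≤ n → ∀ {a b} → η m ≡ zeros a ++ C m ++ zeros b →
    Σ ℕ λ a′ → Σ ℕ λ b′ → η k ≡ zeros a′ ++ C k ++ zeros b′ × b ≤ b′
  trailing-zeros-grow m k m≤k k≤n {a} {b} e with m≤n⇒m<n∨m≡n m≤k
  ... | inj₂ refl = a , b , e , ≤-refl
  trailing-zeros-grow m (suc k) m≤k 1+k≤n {a} {b} e | inj₁ m<1+k =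
    let (a′ , b′ , e′ , b≤b′) = trailing-zeros-grow m k (s≤s⁻¹ m<1+k) (<⇒≤ 1+k≤n) {a} {b} e
        (a″ , b″ , e″ , b′≤b″) = trailing-zeros-step k 1+k≤n {a′} {b′} e′
    in a″ , b″ , e″ , ≤-trans b≤b′ b′≤b″

idList≡applyUpTo : ∀ n f → idList n f ≡ applyUpTo (λ s → f (suc s)) n
idList≡applyUpTo n f = trans (cong (map f) (map-applyUpTo (λ x → x) suc n)) (map-applyUpTo suc f n)

Lex<⇒first-difference : ∀ n (g h : ℕ → ℕ) → Lex-< _≡_ _<_ (applyUpTo g n) (applyUpTo h n) →
  Σ ℕ λ t → t < n × (∀ s → s < t → g s ≡ h s) × g t < h t
Lex<⇒first-difference zero g h (base ())
Lex<⇒first-difference (suc n) g h (this lt) = 0 , s≤s z≤n , (λ s ()) , lt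
Lex<⇒first-difference (suc n) g h (next e r) with Lex<⇒first-difference n (g ∘ suc) (h ∘ suc) r
... | t , t<n , agree , lt = suc t , s≤s t<n , agree′ , lt
  where
  agree′ : ∀ s → s < suc t → g s ≡ h s
  agree′ zero _ = e
  agree′ (suc s) (s≤s s<t) = agree s s<t

first-difference⇒Lex< : ∀ n (g h : ℕ → ℕ) t → t < n → (∀ s → s < t → g s ≡ h s) → g t < h t →
  Lex-< _≡_ _<_ (applyUpTo g n) (applyUpTo h n)
first-difference⇒Lex< (suc n) g h zero _ _ lt = this lt
first-difference⇒Lex< (suc n) g h (suc t) (s≤s t<n) agree lt =
  next (agree 0 (s≤s z≤n)) (first-difference⇒Lex< n (g ∘ suc) (h ∘ suc) t t<n (λ s s<t → agree (suc s) (s≤s s<t)) lt)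

-- A skipped singleton is strong

length-++11 : ∀ (Y : List ℕ) → length (Y ++ 1 ∷ 1 ∷ []) ≡ suc (suc (length Y))
length-++11 Y = trans (length-++ Y) (+-comm (length Y) 2)

reduction-shortens-by-≤1 : ∀ {X j Y} → Reduction X j Y → length X ≢ suc (suc (length Y))
reduction-shortens-by-≤1 r e with length-reduction r
... | inj₁ e′ = <-irrefl (trans e′ e) (≤-trans (n<1+n _) (n≤1+n _))
... | inj₂ e′ = 1+n≢n (sym (suc-injective (trans e′ e)))

-- Y ++ 11 reaches Y in two reductions only by deleting 1s, and a lower first position is impossible:
-- it would delete the first letter, which forces Y ++ 11 to be flat.
++11-no-lower-two-step-reduction : ∀ {V X X' Y jq jq' jp jp'} → V ≡ Y ++ 1 ∷ 1 ∷ [] →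
  Reduction V jq X → Reduction X jq' Y → Reduction V jp X' → Reduction X' jp' Y → jp < jq → ⊥
++11-no-lower-two-step-reduction {V} {Y = Y} {jq} V≡ (decrement _ refl) r₂ _ _ _ =
  reduction-shortens-by-≤1 r₂ (trans (length-decAt (suc jq) V) (trans (cong length V≡) (length-++11 Y)))
++11-no-lower-two-step-reduction _ (drop-first refl _) _ _ _ ()
++11-no-lower-two-step-reduction {V} {Y = Y} {jp = jp} V≡ (drop-last _ _ _) _ (decrement _ refl) r₂′ _ =
  reduction-shortens-by-≤1 r₂′ (trans (length-decAt (suc jp) V) (trans (cong length V≡) (length-++11 Y)))
++11-no-lower-two-step-reduction {V} {X' = X'} {Y = Y} {jp' = jp'} V≡ (drop-last _ _ _) _ (drop-first _ V≡1∷X′) (decrement _ refl) _ =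
  1+n≢n (sym (suc-injective (trans (sym length-V) (trans (cong length V≡) (length-++11 Y)))))
  where
  length-V : length V ≡ suc (length Y)
  length-V = trans (cong length V≡1∷X′) (cong suc (sym (length-decAt (suc jp') X')))
++11-no-lower-two-step-reduction {Y = Y} V≡ (drop-last _ nf _) _ (drop-first _ refl) (drop-first _ refl) _ =
  nf (refl ∷ refl ∷ ++[x,x]≡x∷x∷⇒All≡ Y (sym V≡))
++11-no-lower-two-step-reduction {Y = Y} V≡ (drop-last _ nf _) _ (drop-first _ refl) (drop-last _ _ refl) _ =
  nf (refl ∷ ++[x]≡x∷⇒All≡ (Y ++ 1 ∷ []) (trans (++-assoc Y (1 ∷ []) (1 ∷ [])) (sym V≡)))
++11-no-lower-two-step-reduction _ (drop-last l _ _) _ (drop-last l′ _ _) _ lt = <-irrefl (suc-injective (trans l′ (sym l))) lt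

length-maxChain : ∀ {u w n C l} → MaxChain u w n C → HasChainId w n C l → sum u + n ≡ sum w
length-maxChain {u} {w} {n} {C} {l} (C₀≡w , Cₙ≡u , posC , _) hasId =
  trans (cong (λ z → sum z + n) (sym Cₙ≡u)) (Chain.sum+index w n C l C₀≡w posC hasId n ≤-refl)

module TwoChains (w : Word) (n : ℕ) (C C′ : ℕ → Word) (l l′ : ℕ → ℕ)
  (C₀≡w : C 0 ≡ w) (posC : ∀ k → k ≤ n → Pos (C k)) (hasId : HasChainId w n C l)
  (C′₀≡w : C′ 0 ≡ w) (posC′ : ∀ k → k ≤ n → Pos (C′ k)) (hasId′ : HasChainId w n C′ l′) where

  module A = Chain w n C l C₀≡w posC hasId
  module B = Chain w n C′ l′ C′₀≡w posC′ hasId′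

  same-vertex⇒same-index : ∀ {k m} → k ≤ n → m ≤ n → C′ m ≡ C k → m ≡ k
  same-vertex⇒same-index {k} {m} k≤n m≤n e = +-cancelˡ-≡ (sum (C k)) m k (begin
    sum (C k) + m   ≡⟨ cong (λ z → sum z + m) e ⟨
    sum (C′ m) + m  ≡⟨ B.sum+index m m≤n ⟩
    sum w           ≡⟨ A.sum+index k k≤n ⟨
    sum (C k) + k   ∎)
    where open ≡-Reasoning

  module AgreeingIds (t : ℕ) (t<n : t < n) (ids-agree : ∀ s → s < t → l′ (suc s) ≡ l (suc s)) where

    embeddings-agree : ∀ s → s ≤ t → B.η s ≡ A.η s
    embeddings-agree zero _ = trans B.η₀≡w (sym A.η₀≡w)
    embeddings-agree (suc s) s<t = begin
      B.η (suc s)                 ≡⟨ B.η-step s s<n ⟩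
      decAt (l′ (suc s)) (B.η s)  ≡⟨ cong₂ decAt (ids-agree s s<t) (embeddings-agree s (<⇒≤ s<t)) ⟩
      decAt (l (suc s)) (A.η s)   ≡⟨ A.η-step s s<n ⟨
      A.η (suc s)                 ∎
      where
      open ≡-Reasoning
      s<n : s < n
      s<n = <-≤-trans s<t (<⇒≤ t<n)

    vertices-agree : C′ t ≡ C t
    vertices-agree with B.padded t (<⇒≤ t<n) | A.padded t (<⇒≤ t<n)
    ... | a , b , e | a′ , b′ , e′ =
      padded-injective a b a′ b′ (posC′ t (<⇒≤ t<n)) (posC t (<⇒≤ t<n)) (trans (sym e) (trans (embeddings-agree t ≤-refl) e′))

    stepA : EmbeddedReduction (C t) (A.η t) (l (suc t)) (C (suc t))
    stepA = A.step t t<n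

    stepB : EmbeddedReduction (C t) (A.η t) (l′ (suc t)) (C′ (suc t))
    stepB = subst₂ (λ v η → EmbeddedReduction v η (l′ (suc t)) (C′ (suc t))) vertices-agree (embeddings-agree t ≤-refl) (B.step t t<n)

    earlier⇒lower-letter : l′ (suc t) < l (suc t) → letter stepB < letter stepA
    earlier⇒lower-letter lt with padding-injective (before stepB) (after stepB) (before stepA) (after stepA)
      (posC t (<⇒≤ t<n)) (≤-trans (s≤s z≤n) (letter<length stepA)) (trans (sym (η≡padded stepB)) (η≡padded stepA))
    ... | a≡a′ , _ = +-cancelˡ-< (before stepA) _ _ (s<s⁻¹ (subst (λ a → suc (a + letter stepB) < suc (before stepA + letter stepA))
                          a≡a′ (subst₂ _<_ (p≡position stepB) (p≡position stepA) lt)))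

Strong : Word → Word → Set
Strong v v″ = v ≢ v″ ++ 1 ∷ 1 ∷ []

≢1+⇒≤⊎2+≤ : ∀ {k i} → k ≢ suc i → k ≤ i ⊎ suc (suc i) ≤ k
≢1+⇒≤⊎2+≤ {k} {i} k≢ with <-cmp k (suc i)
... | tri< (s≤s k≤i) _ _ = inj₁ k≤i
... | tri≈ _ k≡ _ = ⊥-elim (k≢ k≡)
... | tri> _ _ i+2≤k = inj₂ i+2≤k

skipped⇒strong : ∀ u w n C l → MaxChain u w n C → HasChainId w n C l → ∀ i₀ → suc i₀ < n →
  Skipped u w n C l i₀ (suc (suc i₀)) → Strong (C i₀) (C (suc (suc i₀)))
skipped⇒strong u w n C l maxC@(C₀≡w , _ , posC , _) hasId i₀ i₀+1<n
  (_ , _ , n′ , C′ , l′ , maxC′@(C′₀≡w , _ , posC′ , _) , hasId′ , earlier , keeps)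
  with refl ← +-cancelˡ-≡ (sum u) n′ n (trans (length-maxChain {l = l′} maxC′ hasId′) (sym (length-maxChain {l = l} maxC hasId)))
  = contradiction-at-first-difference
  where
  open TwoChains w n C C′ l l′ C₀≡w posC hasId C′₀≡w posC′ hasId′

  vertices-kept : ∀ k → k ≤ n → k ≢ suc i₀ → C′ k ≡ C k
  vertices-kept k k≤n k≢ with keeps k k≤n (≢1+⇒≤⊎2+≤ k≢)
  ... | m , m≤n , C′m≡Ck = subst (λ z → C′ z ≡ C k) (same-vertex⇒same-index k≤n m≤n C′m≡Ck) C′m≡Ck

  first-difference : Σ ℕ λ t → t < n × (∀ s → s < t → l′ (suc s) ≡ l (suc s)) × l′ (suc t) < l (suc t)
  first-difference = Lex<⇒first-difference n (l′ ∘ suc) (l ∘ suc)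
    (subst₂ (Lex-< _≡_ _<_) (idList≡applyUpTo n l′) (idList≡applyUpTo n l) earlier)

  contradiction-at-first-difference : Strong (C i₀) (C (suc (suc i₀)))
  contradiction-at-first-difference weak with first-difference
  ... | t , t<n , ids-agree , lt with suc t ≟ suc i₀
  ... | no t≢i₀ = <-irrefl (embeddedReduction-position-unique (posC t (<⇒≤ t<n))
          (subst (EmbeddedReduction (C t) (A.η t) (l′ (suc t))) (vertices-kept (suc t) t<n t≢i₀) stepB) stepA) lt
    where open AgreeingIds t t<n ids-agree
  ... | yes refl = ++11-no-lower-two-step-reduction weak (reduction stepA) (reduction (A.step (suc i₀) i₀+1<n))
          (reduction stepB) (subst (Reduction (C′ (suc i₀)) _) C′i₀+2≡ (reduction (B.step (suc i₀) i₀+1<n)))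
          (earlier⇒lower-letter lt)
    where
    open AgreeingIds t t<n ids-agree
    C′i₀+2≡ : C′ (suc (suc i₀)) ≡ C (suc (suc i₀))
    C′i₀+2≡ = vertices-kept (suc (suc i₀)) i₀+1<n (1+n≢n ∘ suc-injective)

-- Exchanging the two reductions at a strong descent

shiftRight : ℕ → List ℕ → List ℕ
shiftRight δ xs = zeros δ ++ take (length xs ∸ δ) xs

shiftRight-0 : ∀ xs → shiftRight 0 xs ≡ xs
shiftRight-0 xs = take-all (length xs) xs ≤-refl

shiftRight-padded : ∀ δ a v b → shiftRight δ (zeros a ++ v ++ zeros (b + δ)) ≡ zeros (δ + a) ++ v ++ zeros b
shiftRight-padded δ a v b = begin
  zeros δ ++ take (length (zeros a ++ v ++ zeros (b + δ)) ∸ δ) (zeros a ++ v ++ zeros (b + δ))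
    ≡⟨ cong (λ m → zeros δ ++ take m (zeros a ++ v ++ zeros (b + δ))) length∸δ ⟩
  zeros δ ++ take (a + (length v + b)) (zeros a ++ v ++ zeros (b + δ))
    ≡⟨ cong (zeros δ ++_) (take-zeros-++ a _ _) ⟩
  zeros δ ++ zeros a ++ take (length v + b) (v ++ zeros (b + δ))
    ≡⟨ cong (λ z → zeros δ ++ zeros a ++ z) (take-++-zeros v) ⟩
  zeros δ ++ zeros a ++ v ++ zeros b
    ≡⟨ ++-assoc (zeros δ) (zeros a) _ ⟨
  (zeros δ ++ zeros a) ++ v ++ zeros b
    ≡⟨ cong (_++ v ++ zeros b) (zeros-++ δ a) ⟩
  zeros (δ + a) ++ v ++ zeros b ∎
  where
  open ≡-Reasoning
  length∸δ : length (zeros a ++ v ++ zeros (b + δ)) ∸ δ ≡ a + (length v + b)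
  length∸δ = begin
    length (zeros a ++ v ++ zeros (b + δ)) ∸ δ ≡⟨ cong (_∸ δ) (length-padded a v (b + δ)) ⟩
    a + (length v + (b + δ)) ∸ δ              ≡⟨ cong (_∸ δ) (reassociate a (length v) b δ) ⟩
    a + (length v + b) + δ ∸ δ                 ≡⟨ m+n∸n≡m (a + (length v + b)) δ ⟩
    a + (length v + b)                         ∎
    where
    reassociate : ∀ x y z d → x + (y + (z + d)) ≡ x + (y + z) + d
    reassociate x y z d = trans (cong (x +_) (sym (+-assoc y z d))) (sym (+-assoc x (y + z) d))
  take-zeros-++ : ∀ a m (ys : List ℕ) → take (a + m) (zeros a ++ ys) ≡ zeros a ++ take m ys
  take-zeros-++ zero m ys = refl
  take-zeros-++ (suc a) m ys = cong (0 ∷_) (take-zeros-++ a m ys)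
  take-++-zeros : ∀ (xs : List ℕ) → take (length xs + b) (xs ++ zeros (b + δ)) ≡ xs ++ zeros b
  take-++-zeros [] = take-zeros b
    where
    take-zeros : ∀ b → take b (zeros (b + δ)) ≡ zeros b
    take-zeros zero = refl
    take-zeros (suc b) = cong (0 ∷_) (take-zeros b)
  take-++-zeros (x ∷ xs) = cong (x ∷_) (take-++-zeros xs)

decAt-take : ∀ p m (ys : List ℕ) → decAt p (take m ys) ≡ take m (decAt p ys)
decAt-take zero m ys = refl
decAt-take (suc p) zero ys = refl
decAt-take (suc p) (suc m) [] = refl
decAt-take (suc zero) (suc m) (y ∷ ys) = refl
decAt-take (suc (suc p)) (suc m) (y ∷ ys) = cong (y ∷_) (decAt-take (suc p) m ys)

decAt-shiftRight : ∀ δ p xs → decAt (δ + p) (shiftRight δ xs) ≡ shiftRight δ (decAt p xs)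
decAt-shiftRight δ p xs rewrite length-decAt p xs =
  trans (decAt-zeros δ p _) (cong (zeros δ ++_) (decAt-take p (length xs ∸ δ) xs))

shiftRight-mono : ∀ δ {xs ys} → Pointwise _≤_ xs ys → Pointwise _≤_ (shiftRight δ xs) (shiftRight δ ys)
shiftRight-mono δ {ys = ys} xs≤ys rewrite Pointwise.Pointwise-length xs≤ys =
  Pointwise.++⁺ (Pointwise.refl ≤-refl) (take-mono (length ys ∸ δ) xs≤ys)
  where
  take-mono : ∀ m {xs ys : List ℕ} → Pointwise _≤_ xs ys → Pointwise _≤_ (take m xs) (take m ys)
  take-mono zero _ = []
  take-mono (suc m) [] = []
  take-mono (suc m) (x≤y ∷ xs≤ys) = x≤y ∷ take-mono m xs≤ys

-- Reductions v → x → y of the embedding 0ᵃ v 0ᵇ at positions q, then p < q (reaching η₂), redone starting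
-- at p through another middle word; they reach η₂ moved `shift` places to the right.
record Detour (a b : ℕ) (v y : Word) (p : ℕ) (η₂ : List ℕ) : Set where
  field
    shift letter₁ letter₂ before′ after′ before₂ after₂ : ℕ
    middle : Word
    Pos-middle : Pos middle
    p≡position : p ≡ suc (a + letter₁)
    letter₁<length : letter₁ < length v
    reducible₁ : ReducibleAt v letter₁
    first-step : decAt p (zeros a ++ v ++ zeros b) ≡ zeros before′ ++ middle ++ zeros after′
    letter₂<length : letter₂ < length middle
    reducible₂ : ReducibleAt middle letter₂
    second-step : decAt (suc (before′ + letter₂)) (zeros before′ ++ middle ++ zeros after′) ≡ shiftRight shift η₂
    η₂≡padded : η₂ ≡ zeros before₂ ++ y ++ zeros (after₂ + shift)

detour-decrement-decrement : ∀ a b V jq jp → Pos V → 2 ≤ nth V jq → jq < length V → 2 ≤ nth (decAt (suc jq) V) jp → jp < jq →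
  Detour a b V (decAt (suc jp) (decAt (suc jq) V)) (suc (a + jp)) (decAt (suc (a + jp)) (zeros a ++ decAt (suc jq) V ++ zeros b))
detour-decrement-decrement a b V jq jp pV 2≤Vjq jq<V 2≤Xjp jp<jq = record
  { shift = 0 ; letter₁ = jp ; letter₂ = jq ; before′ = a ; after′ = b ; before₂ = a ; after₂ = b ; middle = decAt (suc jp) V
  ; Pos-middle = Pos-decAt jp V pV 2≤Vjp ; p≡position = refl ; letter₁<length = jp<V ; reducible₁ = inj₁ 2≤Vjp
  ; first-step = decAt-padded a b jp V jp<V ; letter₂<length = jq<X′
  ; reducible₂ = inj₁ (subst (2 ≤_) (sym (nth-decAt-≢ jp jq V (<⇒≢ jp<jq))) 2≤Vjq)
  ; second-step = trans (decAt-padded a b jq (decAt (suc jp) V) jq<X′)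
      (trans (cong (λ z → zeros a ++ z ++ zeros b) (decAt-comm (suc jq) (suc jp) V))
             (sym (trans (shiftRight-0 _) (decAt-padded a b jp (decAt (suc jq) V) jp<X))))
  ; η₂≡padded = trans (decAt-padded a b jp (decAt (suc jq) V) jp<X) (cong (λ z → zeros a ++ _ ++ zeros z) (sym (+-identityʳ b))) }
  where
  2≤Vjp : 2 ≤ nth V jp
  2≤Vjp = subst (2 ≤_) (nth-decAt-≢ jq jp V (>⇒≢ jp<jq)) 2≤Xjp
  jp<V : jp < length V
  jp<V = <-trans jp<jq jq<V
  jq<X′ : jq < length (decAt (suc jp) V)
  jq<X′ = subst (jq <_) (sym (length-decAt (suc jp) V)) jq<V
  jp<X : jp < length (decAt (suc jq) V)
  jp<X = subst (jp <_) (sym (length-decAt (suc jq) V)) jp<V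

detour-decrement-dropFirst : ∀ a b V jq Y → Pos V → 2 ≤ nth V jq → jq < length V → decAt (suc jq) V ≡ 1 ∷ Y → 0 < jq →
  Detour a b V Y (suc (a + 0)) (decAt (suc (a + 0)) (zeros a ++ decAt (suc jq) V ++ zeros b))
detour-decrement-dropFirst a b (1 ∷ V′) (suc jq′) .(decAt (suc jq′) V′) (_ ∷ pV′) 2≤Vjq (s≤s jq′<V′) refl _ = record
  { shift = 0 ; letter₁ = 0 ; letter₂ = jq′ ; before′ = suc a ; after′ = b ; before₂ = suc a ; after₂ = b ; middle = V′
  ; Pos-middle = pV′ ; p≡position = refl ; letter₁<length = s≤s z≤n ; reducible₁ = inj₂ (inj₁ (refl , refl))
  ; first-step = decAt-padded-head a b V′ ; letter₂<length = jq′<V′ ; reducible₂ = inj₁ 2≤Vjq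
  ; second-step = trans (decAt-padded (suc a) b jq′ V′ jq′<V′) (sym (trans (shiftRight-0 _) (decAt-padded-head a b _)))
  ; η₂≡padded = trans (decAt-padded-head a b _) (cong (λ z → zeros (suc a) ++ _ ++ zeros z) (sym (+-identityʳ b))) }

Flat? : (v : Word) → Dec (Flat v)
Flat? = all? (_≟ 1)

-- If Y is flat, the last 1 of Y ++ 1 is not reducible; deleting the first 1 instead shifts the embedding.
detour-dropLast-decrement : ∀ a b X jp → Pos X → ¬ Flat (X ++ 1 ∷ []) → 2 ≤ nth X jp → jp < length X →
  Detour a b (X ++ 1 ∷ []) (decAt (suc jp) X) (suc (a + jp)) (decAt (suc (a + jp)) (zeros a ++ X ++ zeros (suc b)))
detour-dropLast-decrement a b X jp pX nf 2≤Xjp jp<X = finish (Flat? Y)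
  where
  Y : Word
  Y = decAt (suc jp) X
  jp<V : jp < length (X ++ 1 ∷ [])
  jp<V = <-trans jp<X (length<length-snoc X)
  2≤Vjp : 2 ≤ nth (X ++ 1 ∷ []) jp
  2≤Vjp = subst (2 ≤_) (sym (nth-++ˡ jp X _ jp<X)) 2≤Xjp
  Pos-Y++1 : Pos (Y ++ 1 ∷ [])
  Pos-Y++1 = All.++⁺ (Pos-decAt jp X pX 2≤Xjp) (s≤s z≤n ∷ [])
  first-step : decAt (suc (a + jp)) (zeros a ++ (X ++ 1 ∷ []) ++ zeros b) ≡ zeros a ++ (Y ++ 1 ∷ []) ++ zeros b
  first-step = trans (decAt-padded a b jp (X ++ 1 ∷ []) jp<V) (cong (λ z → zeros a ++ z ++ zeros b) (decAt-++ˡ jp X (1 ∷ []) jp<X))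
  η₂≡ : decAt (suc (a + jp)) (zeros a ++ X ++ zeros (suc b)) ≡ zeros a ++ Y ++ zeros (suc b)
  η₂≡ = decAt-padded a (suc b) jp X jp<X
  η₂≡′ : decAt (suc (a + jp)) (zeros a ++ X ++ zeros (suc b)) ≡ zeros a ++ Y ++ zeros (b + 1)
  η₂≡′ = trans η₂≡ (cong (λ q → zeros a ++ Y ++ zeros q) (+-comm 1 b))
  finish : Dec (Flat Y) → Detour a b (X ++ 1 ∷ []) Y (suc (a + jp)) (decAt (suc (a + jp)) (zeros a ++ X ++ zeros (suc b)))
  finish (no nfY) = record
    { shift = 0 ; letter₁ = jp ; letter₂ = length Y ; before′ = a ; after′ = b ; before₂ = a ; after₂ = suc b
    ; middle = Y ++ 1 ∷ [] ; Pos-middle = Pos-Y++1 ; p≡position = refl ; letter₁<length = jp<V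
    ; reducible₁ = inj₁ 2≤Vjp ; first-step = first-step ; letter₂<length = length<length-snoc Y
    ; reducible₂ = inj₂ (inj₂ (nfY ∘ All.++⁻ˡ Y , nth-last Y 1 , sym (length-snoc Y 1)))
    ; second-step = trans (decAt-padded-last a b Y) (sym (trans (shiftRight-0 _) η₂≡))
    ; η₂≡padded = trans η₂≡ (cong (λ z → zeros a ++ Y ++ zeros z) (sym (+-identityʳ (suc b)))) }
  finish (yes fY) = record
    { shift = 1 ; letter₁ = jp ; letter₂ = 0 ; before′ = a ; after′ = b ; before₂ = a ; after₂ = b
    ; middle = 1 ∷ Y ; Pos-middle = s≤s z≤n ∷ Pos-decAt jp X pX 2≤Xjp ; p≡position = refl ; letter₁<length = jp<V
    ; reducible₁ = inj₁ 2≤Vjp ; first-step = trans first-step (cong (λ z → zeros a ++ z ++ zeros b) (Flat⇒++[1]≡1∷ Y fY))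
    ; letter₂<length = s≤s z≤n ; reducible₂ = inj₂ (inj₁ (refl , refl))
    ; second-step = trans (decAt-padded-head a b Y) (sym (trans (cong (shiftRight 1) η₂≡′) (shiftRight-padded 1 a Y b)))
    ; η₂≡padded = η₂≡′ }

detour-dropLast-dropFirst : ∀ a b Y → Pos Y → ¬ Flat ((1 ∷ Y) ++ 1 ∷ []) →
  Detour a b ((1 ∷ Y) ++ 1 ∷ []) Y (suc (a + 0)) (decAt (suc (a + 0)) (zeros a ++ (1 ∷ Y) ++ zeros (suc b)))
detour-dropLast-dropFirst a b Y pY nf = record
  { shift = 0 ; letter₁ = 0 ; letter₂ = length Y ; before′ = suc a ; after′ = b ; before₂ = suc a ; after₂ = suc b
  ; middle = Y ++ 1 ∷ [] ; Pos-middle = All.++⁺ pY (s≤s z≤n ∷ []) ; p≡position = refl ; letter₁<length = s≤s z≤n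
  ; reducible₁ = inj₂ (inj₁ (refl , refl)) ; first-step = decAt-padded-head a b (Y ++ 1 ∷ [])
  ; letter₂<length = length<length-snoc Y
  ; reducible₂ = inj₂ (inj₂ (nf ∘ (refl ∷_) , nth-last Y 1 , sym (length-snoc Y 1)))
  ; second-step = trans (decAt-padded-last (suc a) b Y) (sym (trans (shiftRight-0 _) (decAt-padded-head a (suc b) Y)))
  ; η₂≡padded = trans (decAt-padded-head a (suc b) Y) (cong (λ z → zeros (suc a) ++ Y ++ zeros z) (sym (+-identityʳ (suc b)))) }

strong⇒detour : ∀ {a b a₂ b₂ jq jp V X Y} → Pos V → Pos X →
  Reduction V jq X → jq < length V → Reduction X jp Y → jp < length X →
  decAt (suc (a + jq)) (zeros a ++ V ++ zeros b) ≡ zeros a₂ ++ X ++ zeros b₂ →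
  suc (a₂ + jp) < suc (a + jq) → Strong V Y →
  Detour a b V Y (suc (a₂ + jp)) (decAt (suc (a₂ + jp)) (zeros a₂ ++ X ++ zeros b₂))
strong⇒detour {a} {b} {a₂} {b₂} {jq} {jp} {V} pV pX (decrement 2≤Vjq refl) jq<V r₂ jp<X η₁≡ lower strong
  with padding-injective a b a₂ b₂ pX (≤-trans (s≤s z≤n) jp<X) (trans (sym (decAt-padded a b jq V jq<V)) η₁≡)
... | refl , refl = second r₂
  where
  jp<jq : jp < jq
  jp<jq = +-cancelˡ-< a jp jq (s<s⁻¹ lower)
  second : ∀ {Y} → Reduction (decAt (suc jq) V) jp Y →
    Detour a b V Y (suc (a + jp)) (decAt (suc (a + jp)) (zeros a ++ decAt (suc jq) V ++ zeros b))
  second (decrement 2≤Xjp refl) = detour-decrement-decrement a b V jq jp pV 2≤Vjq jq<V 2≤Xjp jp<jq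
  second (drop-first refl X≡) = detour-decrement-dropFirst a b V jq _ pV 2≤Vjq jq<V X≡ jp<jq
  second (drop-last l _ _) = ⊥-elim (<-irrefl (trans l (length-decAt (suc jq) V)) (≤-trans (s≤s jp<jq) jq<V))
strong⇒detour {a} {b} {a₂} {b₂} pV pX (drop-first refl refl) _ _ jp<X η₁≡ lower _
  with padding-injective (suc a) b a₂ b₂ pX (≤-trans (s≤s z≤n) jp<X) (trans (sym (decAt-padded-head a b _)) η₁≡)
... | refl , refl = ⊥-elim (m+n≮m a _ (≤-trans (n≤1+n _) (≤-trans (s<s⁻¹ lower) (≤-reflexive (+-identityʳ a)))))
strong⇒detour {a} {b} {a₂} {b₂} {jq} {jp} {V} {X} {Y} pV pX (drop-last l nf refl) _ r₂ jp<X η₁≡ lower strong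
  with suc-injective (trans l (length-snoc X 1))
... | refl with padding-injective a (suc b) a₂ b₂ pX (≤-trans (s≤s z≤n) jp<X) (trans (sym (decAt-padded-last a b X)) η₁≡)
... | refl , refl = second r₂
  where
  second : Reduction X jp Y → Detour a b (X ++ 1 ∷ []) Y (suc (a + jp)) (decAt (suc (a + jp)) (zeros a ++ X ++ zeros (suc b)))
  second (decrement 2≤Xjp refl) = detour-dropLast-decrement a b X jp pX nf 2≤Xjp jp<X
  second (drop-first refl refl) = detour-dropLast-dropFirst a b Y (All.++⁻ʳ (1 ∷ []) pX) nf
  second (drop-last _ _ refl) = ⊥-elim (strong (++-assoc Y (1 ∷ []) (1 ∷ [])))

splice : {A : Set} → ℕ → (ℕ → A) → A → (ℕ → A) → ℕ → A
splice i f x g k with <-cmp k i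
... | tri< _ _ _ = f k
... | tri≈ _ _ _ = x
... | tri> _ _ _ = g k

module _ {A : Set} (i : ℕ) (f : ℕ → A) (x : A) (g : ℕ → A) where

  splice-< : ∀ {k} → k < i → splice i f x g k ≡ f k
  splice-< {k} k<i with <-cmp k i
  ... | tri< _ _ _ = refl
  ... | tri≈ k≮i _ _ = ⊥-elim (k≮i k<i)
  ... | tri> k≮i _ _ = ⊥-elim (k≮i k<i)

  splice-≡ : splice i f x g i ≡ x
  splice-≡ with <-cmp i i
  ... | tri< _ i≢i _ = ⊥-elim (i≢i refl)
  ... | tri≈ _ _ _ = refl
  ... | tri> _ i≢i _ = ⊥-elim (i≢i refl)

  splice-> : ∀ {k} → i < k → splice i f x g k ≡ g k
  splice-> {k} i<k with <-cmp k i
  ... | tri< _ _ k≯i = ⊥-elim (k≯i i<k)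
  ... | tri≈ _ _ k≯i = ⊥-elim (k≯i i<k)
  ... | tri> _ _ _ = refl

splice-≢ : {A : Set} (i : ℕ) (f : ℕ → A) (x : A) → ∀ {k} → k ≢ i → splice i f x f k ≡ f k
splice-≢ i f x {k} k≢i with <-cmp k i
... | tri< _ _ _ = refl
... | tri≈ _ k≡i _ = ⊥-elim (k≢i k≡i)
... | tri> _ _ _ = refl

position-shift : ∀ δ {p a a′ j} → p ≡ suc (a + j) → a ≡ a′ → δ + p ≡ suc (δ + a′ + j)
position-shift δ {a = a} {j = j} refl refl = trans (+-suc δ (a + j)) (cong suc (sym (+-assoc δ a j)))

ChainStep : Word → Word → List ℕ → ℕ → Word → List ℕ → Set
ChainStep w v η p v′ η′ = Reducible v η p × η′ ≡ decAt p η × IsEmbedding v′ w η′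

-- The chain C with v_i (i = i₀ + 1) replaced by X′, reached from the embedding of v_{i₀} by reducing first
-- at l_{i+1} and then at r′; from v_{i+1} on, all embeddings move δ places to the right.
module EarlierChain (u w : Word) (n : ℕ) (C : ℕ → Word) (l : ℕ → ℕ)
  (C₀≡w : C 0 ≡ w) (Cₙ≡u : C n ≡ u) (posC : ∀ k → k ≤ n → Pos (C k)) (hasId : HasChainId w n C l)
  (i₀ : ℕ) (i₀+1<n : suc i₀ < n) (descent : l (suc (suc i₀)) < l (suc i₀))
  (δ : ℕ) (X′ : Word) (pX′ : Pos X′) (r′ : ℕ)
  (reducible₁ : Reducible (C i₀) (proj₁ hasId i₀) (l (suc (suc i₀))))
  (padded₁ : Padded X′ (decAt (l (suc (suc i₀))) (proj₁ hasId i₀)))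
  (reducible₂ : Reducible X′ (decAt (l (suc (suc i₀))) (proj₁ hasId i₀)) r′)
  (rejoin : decAt r′ (decAt (l (suc (suc i₀))) (proj₁ hasId i₀)) ≡ shiftRight δ (proj₁ hasId (suc (suc i₀))))
  (room : Σ ℕ λ a → Σ ℕ λ b → proj₁ hasId (suc (suc i₀)) ≡ zeros a ++ C (suc (suc i₀)) ++ zeros (b + δ))
  where

  open Chain w n C l C₀≡w posC hasId

  i : ℕ
  i = suc i₀

  η₁ : List ℕ
  η₁ = decAt (l (suc i)) (η i₀)

  C′ : ℕ → Word
  C′ = splice i C X′ C

  η′ : ℕ → List ℕ
  η′ = splice i η η₁ (shiftRight δ ∘ η)

  l′ : ℕ → ℕ
  l′ = splice i l (l (suc i)) (splice (suc i) l r′ ((δ +_) ∘ l))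

  η₁≤w : Pointwise _≤_ η₁ w
  η₁≤w = Pointwise.transitive ≤-trans (decAt-≤ _ _) (η≤w i₀ (<⇒≤ (<-trans (n<1+n i₀) i₀+1<n)))

  tail-padding : ∀ k → suc i ≤ k → k ≤ n → Σ ℕ λ a → Σ ℕ λ b → η k ≡ zeros a ++ C k ++ zeros (b + δ)
  tail-padding k i+1≤k k≤n =
    let (a , b , e) = room
        (a′ , b′ , e′ , b+δ≤b′) = trailing-zeros-grow (suc i) k i+1≤k k≤n {a} {b + δ} e
    in a′ , b′ ∸ δ , trans e′ (cong (λ z → zeros a′ ++ C k ++ zeros z) (sym (m∸n+n≡m (≤-trans (m≤n+m δ b) b+δ≤b′))))

  tail-padded : ∀ k → suc i ≤ k → k ≤ n → Padded (C k) (shiftRight δ (η k))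
  tail-padded k i+1≤k k≤n =
    let (a , b , e) = tail-padding k i+1≤k k≤n
    in δ + a , b , trans (cong (shiftRight δ) e) (shiftRight-padded δ a (C k) b)

  tail-≤w : ∀ k → suc i ≤ k → k ≤ n → Pointwise _≤_ (shiftRight δ (η k)) w
  tail-≤w k i+1≤k k≤n = Pointwise.transitive ≤-trans (shiftRight-mono δ (η-antitone (suc i) k i+1≤k k≤n))
    (subst (λ z → Pointwise _≤_ z w) rejoin (Pointwise.transitive ≤-trans (decAt-≤ r′ η₁) η₁≤w))

  tail-reducible : ∀ k → suc i ≤ k → (k<n : k < n) → Reducible (C k) (shiftRight δ (η k)) (δ + l (suc k))
  tail-reducible k i+1≤k k<n =
    let R = step k k<n
        (a , b , e) = tail-padding k i+1≤k (<⇒≤ k<n)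
        (a≡ , b≡) = padding-injective (before R) (after R) a (b + δ) (posC k (<⇒≤ k<n))
                      (≤-trans (s≤s z≤n) (letter<length R)) (trans (sym (η≡padded R)) e)
    in subst₂ (Reducible (C k))
         (sym (trans (cong (shiftRight δ) e) (shiftRight-padded δ a (C k) b)))
         (sym (position-shift δ (p≡position R) a≡))
         (reducible-padded (δ + a) b (letter<length R) (reducible R))

  C′-≢ : ∀ {k} → k ≢ i → C′ k ≡ C k
  C′-≢ = splice-≢ i C X′

  η′-< : ∀ {k} → k < i → η′ k ≡ η k
  η′-< = splice-< i η η₁ (shiftRight δ ∘ η)

  η′-> : ∀ {k} → i < k → η′ k ≡ shiftRight δ (η k)
  η′-> = splice-> i η η₁ (shiftRight δ ∘ η)

  l′-< : ∀ {k} → k < i → l′ k ≡ l k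
  l′-< = splice-< i l (l (suc i)) _

  l′-> : ∀ {k} → suc i < k → l′ k ≡ δ + l k
  l′-> {k} i+1<k = trans (splice-> i l (l (suc i)) _ (<-trans (n<1+n i) i+1<k)) (splice-> (suc i) l r′ _ i+1<k)

  l′-i+1 : l′ (suc i) ≡ r′
  l′-i+1 = trans (splice-> i l (l (suc i)) _ (n<1+n i)) (splice-≡ (suc i) l r′ _)

  step-before : ∀ k → k < i₀ → ChainStep w (C′ k) (η′ k) (l′ (suc k)) (C′ (suc k)) (η′ (suc k))
  step-before k k<i₀ rewrite C′-≢ (<⇒≢ (<-trans k<i₀ (n<1+n i₀))) | C′-≢ (<⇒≢ (s≤s k<i₀))
    | η′-< (<-trans k<i₀ (n<1+n i₀)) | η′-< (s≤s k<i₀) | l′-< (s≤s k<i₀) =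
    proj₂ (proj₂ hasId) k (<-trans k<i₀ (<-trans (n<1+n i₀) i₀+1<n))

  step-into : ChainStep w (C′ i₀) (η′ i₀) (l′ i) (C′ i) (η′ i)
  step-into rewrite C′-≢ (<⇒≢ (n<1+n i₀)) | splice-≡ i C X′ C | η′-< (n<1+n i₀)
    | splice-≡ i η η₁ (shiftRight δ ∘ η) | splice-≡ i l (l (suc i)) (splice (suc i) l r′ ((δ +_) ∘ l)) =
    reducible₁ , refl , padded₁ , η₁≤w

  step-out : ChainStep w (C′ i) (η′ i) (l′ (suc i)) (C′ (suc i)) (η′ (suc i))
  step-out rewrite splice-≡ i C X′ C | C′-≢ (>⇒≢ (n<1+n i)) | splice-≡ i η η₁ (shiftRight δ ∘ η)
    | η′-> (n<1+n i) | l′-i+1 =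
    reducible₂ , sym rejoin , tail-padded (suc i) ≤-refl i₀+1<n , tail-≤w (suc i) ≤-refl i₀+1<n

  step-after : ∀ k → i < k → k < n → ChainStep w (C′ k) (η′ k) (l′ (suc k)) (C′ (suc k)) (η′ (suc k))
  step-after k i<k k<n rewrite C′-≢ (>⇒≢ i<k) | C′-≢ (>⇒≢ (<-trans i<k (n<1+n k)))
    | η′-> i<k | η′-> (<-trans i<k (n<1+n k)) | l′-> (s≤s i<k) =
    tail-reducible k i<k k<n ,
    trans (cong (shiftRight δ) (η-step k k<n)) (sym (decAt-shiftRight δ (l (suc k)) (η k))) ,
    tail-padded (suc k) (m≤n⇒m≤1+n i<k) k<n , tail-≤w (suc k) (m≤n⇒m≤1+n i<k) k<n

  step′ : ∀ k → k < n → ChainStep w (C′ k) (η′ k) (l′ (suc k)) (C′ (suc k)) (η′ (suc k))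
  step′ k k<n with <-cmp k i₀
  ... | tri< k<i₀ _ _ = step-before k k<i₀
  ... | tri≈ _ refl _ = step-into
  ... | tri> _ _ i₀<k with m≤n⇒m<n∨m≡n i₀<k
  ...   | inj₂ refl = step-out
  ...   | inj₁ i<k = step-after k i<k k<n

  hasId′ : HasChainId w n C′ l′
  hasId′ = η′ , trans (η′-< (s≤s z≤n)) η₀≡w , step′

  C′₀≡w : C′ 0 ≡ w
  C′₀≡w = trans (C′-≢ (λ ())) C₀≡w

  posC′ : ∀ k → k ≤ n → Pos (C′ k)
  posC′ k k≤n with <-cmp k i
  ... | tri< _ _ _ = posC k k≤n
  ... | tri≈ _ _ _ = pX′
  ... | tri> _ _ _ = posC k k≤n

  maxChain′ : MaxChain u w n C′
  maxChain′ = C′₀≡w , trans (C′-≢ (>⇒≢ i₀+1<n)) Cₙ≡u , posC′ , Chain.covers w n C′ l′ C′₀≡w posC′ hasId′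

  earlier : idList n l′ <lex idList n l
  earlier = subst₂ (Lex-< _≡_ _<_) (sym (idList≡applyUpTo n l′)) (sym (idList≡applyUpTo n l))
    (first-difference⇒Lex< n (l′ ∘ suc) (l ∘ suc) i₀ (<-trans (n<1+n i₀) i₀+1<n)
      (λ s s<i₀ → l′-< (s≤s s<i₀)) (subst (_< l i) (sym (splice-≡ i l (l (suc i)) _)) descent))

  skipped : Skipped u w n C l i₀ (suc i)
  skipped = n<1+n i , i₀+1<n , n , C′ , l′ , maxChain′ , hasId′ , earlier , kept
    where
    kept : ∀ k → k ≤ n → (k ≤ i₀ ⊎ suc i ≤ k) → InChain n C′ (C k)
    kept k k≤n (inj₁ k≤i₀) = k , k≤n , C′-≢ (<⇒≢ (s≤s k≤i₀))
    kept k k≤n (inj₂ i+1≤k) = k , k≤n , C′-≢ (>⇒≢ i+1≤k)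

strong⇒skipped : ∀ u w n C l → MaxChain u w n C → HasChainId w n C l → ∀ i₀ → (i₀+1<n : suc i₀ < n) →
  l (suc (suc i₀)) < l (suc i₀) → Strong (C i₀) (C (suc (suc i₀))) → Skipped u w n C l i₀ (suc (suc i₀))
strong⇒skipped u w n C l (C₀≡w , Cₙ≡u , posC , _) hasId i₀ i₀+1<n descent strong = skipped
  where
  open Chain w n C l C₀≡w posC hasId
  i₀<n : i₀ < n
  i₀<n = <-trans (n<1+n i₀) i₀+1<n
  R₁ : EmbeddedReduction (C i₀) (η i₀) (l (suc i₀)) (C (suc i₀))
  R₁ = step i₀ i₀<n
  R₂ : EmbeddedReduction (C (suc i₀)) (η (suc i₀)) (l (suc (suc i₀))) (C (suc (suc i₀)))
  R₂ = step (suc i₀) i₀+1<n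
  η₁≡ : decAt (suc (before R₁ + letter R₁)) (zeros (before R₁) ++ C i₀ ++ zeros (after R₁))
        ≡ zeros (before R₂) ++ C (suc i₀) ++ zeros (after R₂)
  η₁≡ = trans (cong₂ decAt (sym (p≡position R₁)) (sym (η≡padded R₁))) (trans (sym (η-step i₀ i₀<n)) (η≡padded R₂))
  η₂≡ : decAt (suc (before R₂ + letter R₂)) (zeros (before R₂) ++ C (suc i₀) ++ zeros (after R₂)) ≡ η (suc (suc i₀))
  η₂≡ = sym (trans (η-step (suc i₀) i₀+1<n) (cong₂ decAt (p≡position R₂) (η≡padded R₂)))
  detour : Detour (before R₁) (after R₁) (C i₀) (C (suc (suc i₀))) (suc (before R₂ + letter R₂))
             (decAt (suc (before R₂ + letter R₂)) (zeros (before R₂) ++ C (suc i₀) ++ zeros (after R₂)))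
  detour = strong⇒detour (posC i₀ (<⇒≤ i₀<n)) (posC (suc i₀) (<⇒≤ i₀+1<n)) (reduction R₁) (letter<length R₁)
        (reduction R₂) (letter<length R₂) η₁≡ (subst₂ _<_ (p≡position R₂) (p≡position R₁) descent) strong
  module D = Detour detour
  r′ : ℕ
  r′ = suc (D.before′ + D.letter₂)
  first-step : decAt (l (suc (suc i₀))) (η i₀) ≡ zeros D.before′ ++ D.middle ++ zeros D.after′
  first-step = trans (cong₂ decAt (p≡position R₂) (η≡padded R₁)) D.first-step
  reducible₁ : Reducible (C i₀) (η i₀) (l (suc (suc i₀)))
  reducible₁ = subst₂ (Reducible (C i₀)) (sym (η≡padded R₁)) (sym (trans (p≡position R₂) D.p≡position))
    (reducible-padded (before R₁) (after R₁) D.letter₁<length D.reducible₁)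
  reducible₂ : Reducible D.middle (decAt (l (suc (suc i₀))) (η i₀)) r′
  reducible₂ = subst (λ z → Reducible D.middle z r′) (sym first-step)
    (reducible-padded D.before′ D.after′ D.letter₂<length D.reducible₂)
  rejoin : decAt r′ (decAt (l (suc (suc i₀))) (η i₀)) ≡ shiftRight D.shift (η (suc (suc i₀)))
  rejoin = trans (cong (decAt _) first-step) (trans D.second-step (cong (shiftRight D.shift) η₂≡))
  skipped : Skipped u w n C l i₀ (suc (suc i₀))
  skipped =
    EarlierChain.skipped u w n C l C₀≡w Cₙ≡u posC hasId i₀ i₀+1<n descent
      D.shift D.middle D.Pos-middle r′
      reducible₁ (D.before′ , D.after′ , first-step) reducible₂ rejoin
      (D.before₂ , D.after₂ , trans (sym η₂≡) D.η₂≡padded)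

singleton-skipped⇒minSkipped : ∀ {u w n C l i₀} → Skipped u w n C l i₀ (suc (suc i₀)) → MinSkipped u w n C l i₀ (suc (suc i₀))
singleton-skipped⇒minSkipped {u} {w} {n} {C} {l} {i₀} skipped = skipped , no-proper-subinterval
  where
  no-proper-subinterval : ∀ i′ j′ → Skipped u w n C l i′ j′ → i₀ ≤ i′ → j′ ≤ suc (suc i₀) →
    (i′ ≢ i₀ ⊎ j′ ≢ suc (suc i₀)) → ⊥
  no-proper-subinterval i′ j′ (i′+1<j′ , _) i₀≤i′ j′≤i₀+2 proper
    with ≤-antisym (s≤s⁻¹ (s≤s⁻¹ (≤-trans i′+1<j′ j′≤i₀+2))) i₀≤i′
  ... | refl with ≤-antisym j′≤i₀+2 i′+1<j′
  no-proper-subinterval _ _ _ _ _ (inj₁ i′≢i₀) | refl | refl = i′≢i₀ refl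
  no-proper-subinterval _ _ _ _ _ (inj₂ j′≢i₀+2) | refl | refl = j′≢i₀+2 refl

proposition3p6 : (u w : Word) → Pos u → Pos w → u ≼ w →
    (n : ℕ) (C : ℕ → Word) (l : ℕ → ℕ) →
    MaxChain u w n C → HasChainId w n C l →
    (i : ℕ) → 1 ≤ i → i < n → l (suc i) < l i →
    (MinSkipped u w n C l (i ∸ 1) (suc i) ⇔ (C (i ∸ 1) ≢ C (suc i) ++ 1 ∷ 1 ∷ []))
proposition3p6 u w _ _ _ n C l maxC hasId (suc i₀) _ i<n descent = mk⇔
  (λ minSkipped → skipped⇒strong u w n C l maxC hasId i₀ i<n (proj₁ minSkipped))
  (λ strong → singleton-skipped⇒minSkipped (strong⇒skipped u w n C l maxC hasId i₀ i<n descent strong))
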